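{- Let $R$ be a finite ring (associative, with $1\neq 0$) containing the finite field $\mathbb F_q$ as a subring (with the same unit), and let $d=\dim_{\mathbb F_q}R$ (so $\#R=q^d$). Let $R^*$ be the group of units of $R$ and $r^*=\#R^*$. Let $v$ be the number of points of the chain geometry $\Sigma(\mathbb F_q,R)$, and for $i=0,1,2,3$ let $\lambda_i$ be the number of chains containing $i$ given mutually distant points (this number does not depend on the choice of the points). Then \[ \lambda_0=\frac{v\,q^{d-1}r^*}{q^2-1}\lambda_3,\qquad \lambda_1=\frac{q^{d-1}r^*}{q-1}\lambda_3,\qquad \lambda_2=\frac{r^*}{q-1}\lambda_3 . \]
   Context: Here $R$ is regarded as a left vector space over $\mathbb F_q$. The projective line $\mathbb P(R)$ is the set of all submodules of $R^2$ of the form $R(a,b)$, where $(a\ b)$ is the first row of some invertible $2\times 2$ matrix over $R$. The chain geometry $\Sigma(\mathbb F_q,R)$ has as points the elements of $\mathbb P(R)$ and as blocks (chains) the sets $\mathbb P(\mathbb F_q)^g$, $g\in \mathrm{GL}_2(R)$, where $\mathbb P(\mathbb F_q)$ is embedded in $\mathbb P(R)$ via $\mathbb F_q(a,b)\mapsto R(a,b)$ and $\mathrm{GL}_2(R)$ acts on $\mathbb P(R)$ via $R(a,b)\mapsto R((a\ b)g)$. Two points $R(a,b)$, $R(c,d)$ are distant if $\begin{pmatrix}a&b\\c&d\end{pmatrix}\in\mathrm{GL}_2(R)$. -}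

module Defs where

open import Level using (Level; _⊔_)
open import Algebra.Bundles using (Ring)
open import Data.Nat using (ℕ)
open import Data.Product using (Σ; ∃; _×_; _,_)
open import Data.List using (List; length)
open import Data.List.Relation.Unary.All using (All)
open import Data.List.Relation.Unary.Any using (Any)
open import Data.List.Relation.Unary.AllPairs using (AllPairs)
open import Relation.Nullary using (¬_)
open import Relation.Binary.PropositionalEquality using (_≡_)
open import Function.Bundles using (_⇔_)

-- "The number of ~-classes of elements satisfying P is n":
-- a list of n elements satisfying P, pairwise non-equivalent,
-- such that every element satisfying P is equivalent to one of them.
record Card {a p r : Level} {A : Set a} (_~_ : A → A → Set r) (P : A → Set p) (n : ℕ)
       : Set (a ⊔ p ⊔ r) where
  field
    elems    : List A
    size     : length elems ≡ n
    allP     : All P elems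
    distinct : AllPairs (λ x y → ¬ (x ~ y)) elems
    cover    : ∀ x → P x → Any (x ~_) elems

module ChainGeometry {c ℓ : Level} (R : Ring c ℓ) where
  open Ring R

  record Subfield : Set (Level.suc (c ⊔ ℓ)) where
    field
      inF     : Carrier → Set (c ⊔ ℓ)
      inF-resp : ∀ {x y} → x ≈ y → inF x → inF y
      inF-0   : inF 0#
      inF-1   : inF 1#
      inF-+   : ∀ {x y} → inF x → inF y → inF (x + y)
      inF-neg : ∀ {x} → inF x → inF (- x)
      inF-*   : ∀ {x y} → inF x → inF y → inF (x * y)
      inF-comm : ∀ {x y} → inF x → inF y → x * y ≈ y * x
      inF-inv : ∀ {x} → inF x → ¬ (x ≈ 0#) → Σ Carrier λ y → inF y × (x * y ≈ 1#)

  Everything : Carrier → Set (c ⊔ ℓ)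
  Everything _ = Level.Lift (c ⊔ ℓ) Data.Unit.⊤
    where import Data.Unit

  IsUnit : Carrier → Set (c ⊔ ℓ)
  IsUnit x = Σ Carrier λ y → (x * y ≈ 1#) × (y * x ≈ 1#)

  Pair : Set c
  Pair = Carrier × Carrier

  record Mat : Set c where
    constructor mat
    field
      m11 m12 m21 m22 : Carrier
  open Mat public

  _·_ : Mat → Mat → Mat
  g · h = mat (m11 g * m11 h + m12 g * m21 h) (m11 g * m12 h + m12 g * m22 h)
              (m21 g * m11 h + m22 g * m21 h) (m21 g * m12 h + m22 g * m22 h)

  Id : Mat
  Id = mat 1# 0# 0# 1#

  _≈M_ : Mat → Mat → Set ℓ
  g ≈M h = (m11 g ≈ m11 h) × (m12 g ≈ m12 h) × (m21 g ≈ m21 h) × (m22 g ≈ m22 h)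

  EntriesIn : (Carrier → Set (c ⊔ ℓ)) → Mat → Set (c ⊔ ℓ)
  EntriesIn S g = S (m11 g) × S (m12 g) × S (m21 g) × S (m22 g)

  InvertibleIn : (Carrier → Set (c ⊔ ℓ)) → Mat → Set (c ⊔ ℓ)
  InvertibleIn S g = EntriesIn S g × Σ Mat λ h → EntriesIn S h × ((g · h) ≈M Id) × ((h · g) ≈M Id)

  GL₂ : Mat → Set (c ⊔ ℓ)
  GL₂ = InvertibleIn Everything

  AdmissibleIn : (Carrier → Set (c ⊔ ℓ)) → Pair → Set (c ⊔ ℓ)
  AdmissibleIn S (a , b) = Σ Carrier λ x → Σ Carrier λ y → InvertibleIn S (mat a b x y)

  -- representatives of points of P(R)
  Admissible : Pair → Set (c ⊔ ℓ)
  Admissible = AdmissibleIn Everything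

  _≈P_ : Pair → Pair → Set ℓ
  (a , b) ≈P (x , y) = (a ≈ x) × (b ≈ y)

  _∈R_ : Pair → Pair → Set (c ⊔ ℓ)
  (x , y) ∈R (a , b) = Σ Carrier λ r → (x , y) ≈P (r * a , r * b)

  SamePoint : Pair → Pair → Set (c ⊔ ℓ)
  SamePoint p p' = (∀ z → z ∈R p → z ∈R p') × (∀ z → z ∈R p' → z ∈R p)

  _⋆_ : Pair → Mat → Pair
  (a , b) ⋆ g = (a * m11 g + b * m21 g , a * m12 g + b * m22 g)

  Distant : Pair → Pair → Set (c ⊔ ℓ)
  Distant (a , b) (x , y) = GL₂ (mat a b x y)

  module _ (F : Subfield) where
    open Subfield F

    -- the point R p lies on the chain P(F)^g
    OnChain : Mat → Pair → Set (c ⊔ ℓ)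
    OnChain g p = Σ Pair λ u → AdmissibleIn inF u × SamePoint (u ⋆ g) p

    SameChain : Mat → Mat → Set (c ⊔ ℓ)
    SameChain g h = ∀ p → Admissible p → (OnChain g p ⇔ OnChain h p)

-- Count flags (chain, point) in two ways.  Every chain is the image of ℙ(F) under some g ∈ GL₂(R), so it
-- has q + 1 points, any two of which are distant; and GL₂(R) permutes the chains and acts transitively on
-- points, on pairs of distant points and on triples of mutually distant points (a triple can be carried
-- to R(1,0), R(0,1), R(1,1)).  Counting
--   chains with a point on them                                   gives  λ₀ (q + 1) = v λ₁,
--   chains through p₁ with a point on them distant from p₁        gives  λ₁ q = #R λ₂,
--   chains through p₁, p₂ with a point on them distant from both  gives  λ₂ (q − 1) = r* λ₃,
-- because the points distant from R(0,1) are the R(1,a), a ∈ R, and those distant from R(1,0) and R(0,1)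
-- are the R(1,u), u ∈ R*.  With #R = q^d these three equations give the theorem.

module Submission where

open import Defs
open import Level using (Level; lift)
open import Algebra.Bundles using (Ring)
open import Data.Product using (∃; _×_; _,_; proj₁; proj₂)
open import Data.Sum using (_⊎_; inj₁; inj₂)
open import Data.Empty using (⊥-elim)
open import Function.Base using (_∘_; id)
open import Relation.Nullary using (¬_; Dec; yes; no)
open import Relation.Binary.Core using (Rel)
open import Relation.Binary.Structures using (IsEquivalence)
open import Relation.Binary.Definitions using (Decidable)
open import Function.Bundles using (mk⇔; Equivalence)

module Counting where
  open import Data.Nat using (ℕ; zero; suc; _+_; _*_)
  open import Data.Nat.Properties using (suc-injective)
  import Data.Product as Product
  open import Data.Product.Relation.Binary.Pointwise.NonDependent using (Pointwise; ×-isEquivalence)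
  open import Data.Sum using ([_,_]′)
  open import Data.List using (List; []; _∷_; length; map; _++_)
  open import Data.List.Properties using (length-++; length-map; length-removeAt′)
  open import Data.List.Relation.Unary.All as All using (All; []; _∷_)
  import Data.List.Relation.Unary.All.Properties as Allₚ
  open import Data.List.Relation.Unary.Any as Any using (Any; here; there; _─_)
  import Data.List.Relation.Unary.Any.Properties as Anyₚ
  open import Data.List.Relation.Unary.AllPairs as AllPairs using (AllPairs; []; _∷_)
  import Data.List.Relation.Unary.AllPairs.Properties as AllPairsₚ
  open import Relation.Unary using (_⊆_; _≐_)
  open import Relation.Binary.PropositionalEquality using (_≡_; refl; sym; trans; cong; cong₂)
  open import Data.Product using (swap)

  module _ {a r} {A : Set a} {_~_ : Rel A r} (~-equiv : IsEquivalence _~_) where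
    open IsEquivalence ~-equiv using () renaming (sym to ~-sym; trans to ~-trans)

    private
      Apart : Rel A r
      Apart x y = ¬ x ~ y

      ─-apart : ∀ {x} {xs : List A} (i : Any (x ~_) xs) → AllPairs Apart xs →
        All (λ y → ¬ y ~ x) (xs ─ i)
      ─-apart (here x~y) (y≁ ∷ _) = All.map (λ y≁z z~x → y≁z (~-sym (~-trans z~x x~y))) y≁
      ─-apart (there i) (y≁ ∷ apart) with All.lookupAny y≁ i
      ... | y≁e , x~e = (λ y~x → y≁e (~-trans y~x x~e)) ∷ ─-apart i apart

      ─-allPairs : ∀ {x} {xs : List A} (i : Any (x ~_) xs) → AllPairs Apart xs → AllPairs Apart (xs ─ i)
      ─-allPairs (here _) (_ ∷ apart) = apart
      ─-allPairs (there i) (y≁ ∷ apart) = Allₚ.─⁺ i y≁ ∷ ─-allPairs i apart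

      ─-cover : ∀ {x y} {xs : List A} (i : Any (x ~_) xs) → Any (y ~_) xs → ¬ y ~ x → Any (y ~_) (xs ─ i)
      ─-cover (here x~e) (here y~e) y≁x = ⊥-elim (y≁x (~-trans y~e (~-sym x~e)))
      ─-cover (here _) (there j) _ = j
      ─-cover (there i) (here y~e) _ = here y~e
      ─-cover (there i) (there j) y≁x = there (─-cover i j y≁x)

    private variable
      p q : Level
      P : A → Set p
      Q : A → Set q

    card-witness : ∀ {n} → Card _~_ P (suc n) → ∃ P
    card-witness record { elems = x ∷ _ ; allP = px ∷ _ } = x , px

    card-empty : ∀ {x} → Card _~_ P zero → ¬ P x
    card-empty {x = x} C px with Card.elems C | Card.size C | Card.cover C x px
    ... | [] | _ | ()

    card-remove : ∀ {n x} → Card _~_ P (suc n) → P x → Card _~_ (λ y → P y × ¬ y ~ x) n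
    card-remove {x = x} C px = record
      { elems = elems ─ i
      ; size = suc-injective (trans (sym (length-removeAt′ elems (Any.index i))) size)
      ; allP = All.zip (Allₚ.─⁺ i allP , ─-apart i distinct)
      ; distinct = ─-allPairs i distinct
      ; cover = λ y (py , y≁x) → ─-cover i (cover y py) y≁x
      }
      where
        open Card C
        i : Any (x ~_) elems
        i = cover x px

    card-inhabited : ∀ {n x} → Card _~_ P n → P x → ∃ λ k → n ≡ suc k
    card-inhabited {n = zero} C px = ⊥-elim (card-empty C px)
    card-inhabited {n = suc k} _ _ = k , refl

    card-two : ∀ {n x y} → Card _~_ P n → P x → P y → ¬ x ~ y → ∃ λ k → n ≡ suc (suc k)
    card-two C px py x≁y with card-inhabited C px
    ... | k , refl with card-inhabited (card-remove C px) (py , x≁y ∘ ~-sym)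
    ...   | k′ , refl = k′ , refl

    card-insert : ∀ {n x} → Card _~_ Q n → P x → Q ⊆ P → (∀ {y} → Q y → ¬ y ~ x) →
      (∀ y → P y → y ~ x ⊎ Q y) → Card _~_ P (suc n)
    card-insert {x = x} C px Q⊆P Q≁x split = record
      { elems = x ∷ elems
      ; size = cong suc size
      ; allP = px ∷ All.map Q⊆P allP
      ; distinct = All.map (λ qy x~y → Q≁x qy (~-sym x~y)) allP ∷ distinct
      ; cover = λ y py → [ here , there ∘ cover y ]′ (split y py)
      }
      where open Card C

    card-cong : ∀ {n} → P ≐ Q → Card _~_ P n → Card _~_ Q n
    card-cong (P⊆Q , Q⊆P) C = record
      { elems = elems ; size = size ; allP = All.map P⊆Q allP ; distinct = distinct
      ; cover = λ x qx → cover x (Q⊆P qx) }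
      where open Card C

    card-unique : ∀ {n m} → Card _~_ P n → Card _~_ Q m → P ≐ Q → n ≡ m
    card-unique {n = zero} {zero} _ _ _ = refl
    card-unique {n = zero} {suc m} C D (_ , Q⊆P) = ⊥-elim (card-empty C (Q⊆P (proj₂ (card-witness D))))
    card-unique {n = suc n} {zero} C D (P⊆Q , _) = ⊥-elim (card-empty D (P⊆Q (proj₂ (card-witness C))))
    card-unique {n = suc n} {suc m} C D (P⊆Q , Q⊆P) with card-witness C
    ... | x , px = cong suc (card-unique (card-remove C px) (card-remove D (P⊆Q px))
                               (Product.map₁ P⊆Q , Product.map₁ Q⊆P))

    card-decidable : ∀ {n x y} → Card _~_ P n → P x → P y → Dec (x ~ y)
    card-decidable {x = x} {y} C px py = decide distinct (cover x px) (cover y py)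
      where
        open Card C
        decide : ∀ {xs} → AllPairs Apart xs → Any (x ~_) xs → Any (y ~_) xs → Dec (x ~ y)
        decide _ (here x~e) (here y~e) = yes (~-trans x~e (~-sym y~e))
        decide (e≁ ∷ _) (here x~e) (there j) with All.lookupAny e≁ j
        ... | e≁f , y~f = no λ x~y → e≁f (~-trans (~-sym x~e) (~-trans x~y y~f))
        decide (e≁ ∷ _) (there i) (here y~e) with All.lookupAny e≁ i
        ... | e≁f , x~f = no λ x~y → e≁f (~-trans (~-sym y~e) (~-trans (~-sym x~y) x~f))
        decide (_ ∷ apart) (there i) (there j) = decide apart i j

  private variable
    a b p q r s : Level
    A : Set a
    B : Set b
    P : A → Set p
    P′ : B → Set p
    Q : A → B → Set q
    Q′ : B → A → Set q

  card-image : ∀ {_~_ : Rel A r} {_≋_ : Rel B s} → IsEquivalence _≋_ →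
    ∀ {n} {Q : B → Set q} (f : A → B) → Card _~_ P n →
    (∀ {x} → P x → Q (f x)) →
    (∀ {x y} → P x → P y → x ~ y → f x ≋ f y) →
    (∀ {x y} → P x → P y → f x ≋ f y → x ~ y) →
    (∀ y → Q y → ∃ λ x → P x × f x ≋ y) →
    Card _≋_ Q n
  card-image {P = P} {_~_ = _~_} {_≋_} ≋-equiv f C f-P f-resp f-reflects f-surj = record
    { elems = map f elems
    ; size = trans (length-map f elems) size
    ; allP = Allₚ.map⁺ (All.map f-P allP)
    ; distinct = distinct′ allP distinct
    ; cover = λ y qy → let (x , px , fx≋y) = f-surj y qy in cover′ px fx≋y allP (cover x px)
    }
    where
      open Card C
      open IsEquivalence ≋-equiv using () renaming (sym to ≋-sym; trans to ≋-trans)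
      distinct′ : ∀ {xs} → All P xs → AllPairs (λ x y → ¬ x ~ y) xs → AllPairs (λ u v → ¬ u ≋ v) (map f xs)
      distinct′ [] [] = []
      distinct′ (px ∷ pxs) (x≁ ∷ apart) =
        Allₚ.map⁺ (All.zipWith (λ (py , x≁y) fx≋fy → x≁y (f-reflects px py fx≋fy)) (pxs , x≁))
        ∷ distinct′ pxs apart
      cover′ : ∀ {x y xs} → P x → f x ≋ y → All P xs → Any (x ~_) xs → Any (y ≋_) (map f xs)
      cover′ px fx≋y (pe ∷ _) (here x~e) = here (≋-trans (≋-sym fx≋y) (f-resp px pe x~e))
      cover′ px fx≋y (_ ∷ pxs) (there i) = there (cover′ px fx≋y pxs i)

  card-product : ∀ {_~_ : Rel A r} {_≋_ : Rel B s} {n m} →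
    Card _~_ P n → (∀ {x} → P x → Card _≋_ (Q x) m) →
    (∀ {x x′} → P x → P x′ → x ~ x′ → Q x ⊆ Q x′) →
    Card (Pointwise _~_ _≋_) (λ (x , y) → P x × Q x y) (n * m)
  card-product {A = A} {B = B} {P = P} {Q = Q} {_~_ = _~_} {_≋_} {m = m} C fibre Q-resp = record
    { elems = fibres allP
    ; size = trans (length-fibres allP) (cong (_* m) size)
    ; allP = fibres-allP allP
    ; distinct = fibres-distinct allP distinct
    ; cover = λ (x , y) (px , qxy) → fibres-cover px qxy allP (cover x px)
    }
    where
      open Card C
      fibreAt : ∀ {x} → P x → List (A × B)
      fibreAt {x = x} px = map (x ,_) (Card.elems (fibre px))
      fibres : ∀ {xs} → All P xs → List (A × B)
      fibres [] = []
      fibres (px ∷ pxs) = fibreAt px ++ fibres pxs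
      length-fibres : ∀ {xs} (pxs : All P xs) → length (fibres pxs) ≡ length xs * m
      length-fibres [] = refl
      length-fibres (px ∷ pxs) = trans (length-++ (fibreAt px))
        (cong₂ _+_ (trans (length-map _ (Card.elems (fibre px))) (Card.size (fibre px))) (length-fibres pxs))
      fibres-fst : ∀ {t} {T : A → Set t} {xs} (pxs : All P xs) → All T xs → All (T ∘ proj₁) (fibres pxs)
      fibres-fst [] [] = []
      fibres-fst (px ∷ pxs) (tx ∷ txs) = Allₚ.++⁺ (Allₚ.map⁺ (All.universal (λ _ → tx) _)) (fibres-fst pxs txs)
      fibres-allP : ∀ {xs} (pxs : All P xs) → All (λ (x , y) → P x × Q x y) (fibres pxs)
      fibres-allP [] = []
      fibres-allP (px ∷ pxs) = Allₚ.++⁺ (Allₚ.map⁺ (All.map (px ,_) (Card.allP (fibre px)))) (fibres-allP pxs)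
      fibres-distinct : ∀ {xs} (pxs : All P xs) → AllPairs (λ x y → ¬ x ~ y) xs →
        AllPairs (λ u v → ¬ Pointwise _~_ _≋_ u v) (fibres pxs)
      fibres-distinct [] [] = []
      fibres-distinct (px ∷ pxs) (x≁ ∷ apart) = AllPairsₚ.++⁺
        (AllPairsₚ.map⁺ (AllPairs.map (_∘ proj₂) (Card.distinct (fibre px))))
        (fibres-distinct pxs apart)
        (Allₚ.map⁺ (All.universal (λ _ → All.map (_∘ proj₁) (fibres-fst pxs x≁)) _))
      fibres-cover : ∀ {x y xs} → P x → Q x y → (pxs : All P xs) → Any (x ~_) xs →
        Any (Pointwise _~_ _≋_ (x , y)) (fibres pxs)
      fibres-cover {y = y} px qxy (pe ∷ pxs) (here x~e) =
        Anyₚ.++⁺ˡ (Anyₚ.map⁺ (Any.map (x~e ,_) (Card.cover (fibre pe) y (Q-resp px pe x~e qxy))))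
      fibres-cover px qxy (pe ∷ pxs) (there i) = Anyₚ.++⁺ʳ (fibreAt pe) (fibres-cover px qxy pxs i)

  double-count : ∀ {_~_ : Rel A r} {_≋_ : Rel B s} → IsEquivalence _~_ → IsEquivalence _≋_ → ∀ {n m n′ m′} →
    Card _~_ P n → (∀ {x} → P x → Card _≋_ (Q x) m) → (∀ {x x′} → P x → P x′ → x ~ x′ → Q x ⊆ Q x′) →
    Card _≋_ P′ n′ → (∀ {y} → P′ y → Card _~_ (Q′ y) m′) →
    (∀ {y y′} → P′ y → P′ y′ → y ≋ y′ → Q′ y ⊆ Q′ y′) →
    (∀ {x y} → P x → Q x y → P′ y × Q′ y x) → (∀ {x y} → P′ y → Q′ y x → P x × Q x y) →
    n * m ≡ n′ * m′
  double-count {P′ = P′} {Q′ = Q′} {_~_ = _~_} {_≋_} ~-equiv ≋-equiv {n′ = n′} {m′}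
               A fibreA resp-A B fibreB resp-B to from =
    card-unique ~×≋-equiv (card-product A fibreA resp-A) B′
      ((λ (px , qxy) → to px qxy) , (λ (py , q′yx) → from py q′yx))
    where
      ~×≋-equiv : IsEquivalence (Pointwise _~_ _≋_)
      ~×≋-equiv = ×-isEquivalence ~-equiv ≋-equiv
      B′ : Card (Pointwise _~_ _≋_) (λ (x , y) → P′ y × Q′ y x) (n′ * m′)
      B′ = card-image ~×≋-equiv swap (card-product B fibreB resp-B)
        id (λ _ _ → swap) (λ _ _ → swap) (λ (x , y) pq → (y , x) , pq , IsEquivalence.refl ~×≋-equiv)

open Counting

module Arithmetic where
  open import Data.Nat using (ℕ; zero; suc; _+_; _*_; _^_; _∸_)
  open import Data.Nat.Properties using (*-cancelʳ-≡; *-comm)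
  open import Data.Nat.Tactic.RingSolver using (solve-∀; solve)
  open import Data.List using (_∷_; [])
  open import Relation.Binary.PropositionalEquality using (_≡_; refl; cong; trans)
  open Relation.Binary.PropositionalEquality.≡-Reasoning

  suc[n]²∸1≡n*[2+n] : ∀ n → suc n ^ 2 ∸ 1 ≡ n * (2 + n)
  suc[n]²∸1≡n*[2+n] n = cong (_∸ 1) (expand n)
    where
      -- (1 + n) ^ 2 unfolded by hand, as the ring solver does not understand Data.Nat._^_
      expand : ∀ n → (1 + n) * ((1 + n) * 1) ≡ 1 + n * (2 + n)
      expand = solve-∀

  incidence-arithmetic : ∀ q′ Q {v r λ₀ λ₁ λ₂ λ₃} →
    λ₀ * (2 + q′) ≡ v * λ₁ → λ₁ * suc q′ ≡ suc q′ * Q * λ₂ → λ₂ * q′ ≡ r * λ₃ →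
    ((suc q′ ^ 2 ∸ 1) * λ₀ ≡ v * Q * r * λ₃) × (q′ * λ₁ ≡ Q * r * λ₃) × (q′ * λ₂ ≡ r * λ₃)
  incidence-arithmetic q′ Q {v} {r} {λ₀} {λ₁} {λ₂} {λ₃} eq₀ eq₁ eq₂ = eq₀′ , eq₁′ , eq₂′
    where
      λ₁≡Qλ₂ : λ₁ ≡ Q * λ₂
      λ₁≡Qλ₂ = *-cancelʳ-≡ λ₁ (Q * λ₂) (suc q′) (trans eq₁ (solve (q′ ∷ Q ∷ λ₂ ∷ [])))
      eq₂′ : q′ * λ₂ ≡ r * λ₃
      eq₂′ = trans (*-comm q′ λ₂) eq₂
      eq₁′ : q′ * λ₁ ≡ Q * r * λ₃
      eq₁′ = begin
        q′ * λ₁       ≡⟨ cong (q′ *_) λ₁≡Qλ₂ ⟩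
        q′ * (Q * λ₂) ≡⟨ solve (q′ ∷ Q ∷ λ₂ ∷ []) ⟩
        Q * (q′ * λ₂) ≡⟨ cong (Q *_) eq₂′ ⟩
        Q * (r * λ₃)  ≡⟨ solve (Q ∷ r ∷ λ₃ ∷ []) ⟩
        Q * r * λ₃    ∎
      eq₀′ : (suc q′ ^ 2 ∸ 1) * λ₀ ≡ v * Q * r * λ₃
      eq₀′ = begin
        (suc q′ ^ 2 ∸ 1) * λ₀ ≡⟨ cong (_* λ₀) (suc[n]²∸1≡n*[2+n] q′) ⟩
        q′ * (2 + q′) * λ₀    ≡⟨ solve (q′ ∷ λ₀ ∷ []) ⟩
        q′ * (λ₀ * (2 + q′))  ≡⟨ cong (q′ *_) eq₀ ⟩
        q′ * (v * λ₁)         ≡⟨ solve (q′ ∷ v ∷ λ₁ ∷ []) ⟩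
        v * (q′ * λ₁)         ≡⟨ cong (v *_) eq₁′ ⟩
        v * (Q * r * λ₃)      ≡⟨ solve (v ∷ Q ∷ r ∷ λ₃ ∷ []) ⟩
        v * Q * r * λ₃        ∎

  ^-exponent-nonzero : ∀ q d {k} → q ^ d ≡ suc (suc k) → ∃ λ d′ → d ≡ suc d′
  ^-exponent-nonzero q zero ()
  ^-exponent-nonzero q (suc d′) _ = d′ , refl

open Arithmetic

module Matrices {c ℓ} (R : Ring c ℓ) where
  open Ring R
  open ChainGeometry R
  open import Relation.Binary.Reasoning.Setoid setoid
  open import Algebra.Properties.CommutativeSemigroup +-commutativeSemigroup using (interchange)

  +-eliminateʳ : ∀ {a b x} → a ≈ x → b ≈ 0# → a + b ≈ x
  +-eliminateʳ a≈x b≈0 = trans (+-cong a≈x b≈0) (+-identityʳ _)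

  +-eliminateˡ : ∀ {a b x} → a ≈ 0# → b ≈ x → a + b ≈ x
  +-eliminateˡ a≈0 b≈x = trans (+-cong a≈0 b≈x) (+-identityˡ _)

  1*x+0*y≈x : ∀ x y → 1# * x + 0# * y ≈ x
  1*x+0*y≈x x y = +-eliminateʳ (*-identityˡ x) (zeroˡ y)

  0*x+1*y≈y : ∀ x y → 0# * x + 1# * y ≈ y
  0*x+1*y≈y x y = +-eliminateˡ (zeroˡ x) (*-identityˡ y)

  x*1+y*0≈x : ∀ x y → x * 1# + y * 0# ≈ x
  x*1+y*0≈x x y = +-eliminateʳ (*-identityʳ x) (zeroʳ y)

  x*0+y*1≈y : ∀ x y → x * 0# + y * 1# ≈ y
  x*0+y*1≈y x y = +-eliminateˡ (zeroʳ x) (*-identityʳ y)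

  *-distribˡ-+-assoc : ∀ r a b x y → r * (a * x + b * y) ≈ (r * a) * x + (r * b) * y
  *-distribˡ-+-assoc r a b x y = trans (distribˡ r _ _) (+-cong (sym (*-assoc r a x)) (sym (*-assoc r b y)))

  -- the (i,j) entry of (g h) k and of g (h k), for 2×2 matrices and for row vectors
  dot-assoc : ∀ a b c d e f g h → (a * b + c * d) * e + (a * f + c * g) * h ≈ a * (b * e + f * h) + c * (d * e + g * h)
  dot-assoc a b c d e f g h = begin
    (a * b + c * d) * e + (a * f + c * g) * h                 ≈⟨ +-cong (distrib-assoc a b c d e) (distrib-assoc a f c g h) ⟩
    (a * (b * e) + c * (d * e)) + (a * (f * h) + c * (g * h)) ≈⟨ interchange _ _ _ _ ⟩
    (a * (b * e) + a * (f * h)) + (c * (d * e) + c * (g * h)) ≈⟨ +-cong (distribˡ a _ _) (distribˡ c _ _) ⟨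
    a * (b * e + f * h) + c * (d * e + g * h)                 ∎
    where
      distrib-assoc : ∀ a b c d e → (a * b + c * d) * e ≈ a * (b * e) + c * (d * e)
      distrib-assoc a b c d e = trans (distribʳ e (a * b) (c * d)) (+-cong (*-assoc a b e) (*-assoc c d e))

  isUnit-resp : ∀ {x y} → x ≈ y → IsUnit x → IsUnit y
  isUnit-resp x≈y (x′ , xx′≈1 , x′x≈1) =
    x′ , trans (*-congʳ (sym x≈y)) xx′≈1 , trans (*-congˡ (sym x≈y)) x′x≈1

  isUnit-* : ∀ {x y} → IsUnit x → IsUnit y → IsUnit (x * y)
  isUnit-* {x} {y} (x′ , xx′≈1 , x′x≈1) (y′ , yy′≈1 , y′y≈1) =
    y′ * x′ , cancel x y xx′≈1 yy′≈1 , cancel y′ x′ y′y≈1 x′x≈1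
    where
      cancel : ∀ x y {x′ y′} → x * x′ ≈ 1# → y * y′ ≈ 1# → (x * y) * (y′ * x′) ≈ 1#
      cancel x y {x′} {y′} xx′≈1 yy′≈1 = begin
        (x * y) * (y′ * x′) ≈⟨ *-assoc x y _ ⟩
        x * (y * (y′ * x′)) ≈⟨ *-congˡ (*-assoc y y′ x′) ⟨
        x * ((y * y′) * x′) ≈⟨ *-congˡ (trans (*-congʳ yy′≈1) (*-identityˡ x′)) ⟩
        x * x′              ≈⟨ xx′≈1 ⟩
        1#                  ∎

  ≈M-isEquivalence : IsEquivalence _≈M_
  ≈M-isEquivalence = record
    { refl = refl , refl , refl , refl
    ; sym = λ (a , b , c , d) → sym a , sym b , sym c , sym d
    ; trans = λ (a , b , c , d) (a′ , b′ , c′ , d′) → trans a a′ , trans b b′ , trans c c′ , trans d d′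
    }

  module ≈M = IsEquivalence ≈M-isEquivalence

  ·-cong : ∀ {g g′ h h′} → g ≈M g′ → h ≈M h′ → (g · h) ≈M (g′ · h′)
  ·-cong (a , b , c , d) (a′ , b′ , c′ , d′) =
    +-cong (*-cong a a′) (*-cong b c′) , +-cong (*-cong a b′) (*-cong b d′) ,
    +-cong (*-cong c a′) (*-cong d c′) , +-cong (*-cong c b′) (*-cong d d′)

  ·-assoc : ∀ g h k → ((g · h) · k) ≈M (g · (h · k))
  ·-assoc (mat g₁ g₂ g₃ g₄) (mat h₁ h₂ h₃ h₄) (mat k₁ k₂ k₃ k₄) =
    dot-assoc g₁ h₁ g₂ h₃ k₁ h₂ h₄ k₃ , dot-assoc g₁ h₁ g₂ h₃ k₂ h₂ h₄ k₄ ,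
    dot-assoc g₃ h₁ g₄ h₃ k₁ h₂ h₄ k₃ , dot-assoc g₃ h₁ g₄ h₃ k₂ h₂ h₄ k₄

  ·-identityˡ : ∀ g → (Id · g) ≈M g
  ·-identityˡ (mat a b c d) = 1*x+0*y≈x a c , 1*x+0*y≈x b d , 0*x+1*y≈y a c , 0*x+1*y≈y b d

  ·-identityʳ : ∀ g → (g · Id) ≈M g
  ·-identityʳ (mat a b c d) = x*1+y*0≈x a b , x*0+y*1≈y a b , x*1+y*0≈x c d , x*0+y*1≈y c d

  ·-cancelʳ : ∀ g {h h′} → (h · h′) ≈M Id → ((g · h) · h′) ≈M g
  ·-cancelʳ g {h} {h′} hh′≈1 =
    ≈M.trans (·-assoc g h h′) (≈M.trans (·-cong (≈M.refl {g}) hh′≈1) (·-identityʳ g))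

  GL₂-intro : ∀ {g} h → (g · h) ≈M Id → (h · g) ≈M Id → GL₂ g
  GL₂-intro h gh≈1 hg≈1 = (lift _ , lift _ , lift _ , lift _) , h , (lift _ , lift _ , lift _ , lift _) , gh≈1 , hg≈1

  inverse : ∀ {g} → GL₂ g → Mat
  inverse (_ , h , _) = h

  ·-inverseʳ : ∀ {g} (G : GL₂ g) → (g · inverse G) ≈M Id
  ·-inverseʳ (_ , _ , _ , gh≈1 , _) = gh≈1

  ·-inverseˡ : ∀ {g} (G : GL₂ g) → (inverse G · g) ≈M Id
  ·-inverseˡ (_ , _ , _ , _ , hg≈1) = hg≈1

  GL₂-inverse : ∀ {g} (G : GL₂ g) → GL₂ (inverse G)
  GL₂-inverse G = GL₂-intro _ (·-inverseˡ G) (·-inverseʳ G)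

  GL₂-resp : ∀ {g g′} → g ≈M g′ → GL₂ g → GL₂ g′
  GL₂-resp g≈g′ G = GL₂-intro (inverse G)
    (≈M.trans (·-cong (≈M.sym g≈g′) ≈M.refl) (·-inverseʳ G))
    (≈M.trans (·-cong ≈M.refl (≈M.sym g≈g′)) (·-inverseˡ G))

  GL₂-· : ∀ {g h} → GL₂ g → GL₂ h → GL₂ (g · h)
  GL₂-· {g} {h} G H = GL₂-intro (inverse H · inverse G) (cancel-middle g h (·-inverseʳ H) (·-inverseʳ G))
                                                        (cancel-middle (inverse H) (inverse G) (·-inverseˡ G) (·-inverseˡ H))
    where
      cancel-middle : ∀ g h {h′ g′} → (h · h′) ≈M Id → (g · g′) ≈M Id → ((g · h) · (h′ · g′)) ≈M Id
      cancel-middle g h {h′} {g′} hh′≈1 gg′≈1 =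
        ≈M.trans (≈M.sym (·-assoc (g · h) h′ g′)) (≈M.trans (·-cong (·-cancelʳ g hh′≈1) (≈M.refl {g′})) gg′≈1)

  upper lower : Carrier → Mat
  upper x = mat 1# x 0# 1#
  lower x = mat 1# 0# x 1#

  diagonal : Carrier → Carrier → Mat
  diagonal r s = mat r 0# 0# s

  Swap : Mat
  Swap = mat 0# 1# 1# 0#

  upper-· : ∀ x y → (upper x · upper y) ≈M upper (y + x)
  upper-· x y = +-eliminateʳ (*-identityˡ 1#) (zeroʳ x) , +-cong (*-identityˡ y) (*-identityʳ x) ,
                +-eliminateˡ (zeroˡ 1#) (zeroʳ 1#) , +-eliminateˡ (zeroˡ y) (*-identityˡ 1#)

  lower-· : ∀ x y → (lower x · lower y) ≈M lower (x + y)
  lower-· x y = +-eliminateʳ (*-identityˡ 1#) (zeroˡ y) , +-eliminateʳ (zeroʳ 1#) (zeroˡ 1#) ,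
                +-cong (*-identityʳ x) (*-identityˡ y) , +-eliminateˡ (zeroʳ x) (*-identityˡ 1#)

  diagonal-· : ∀ r s r′ s′ → (diagonal r s · diagonal r′ s′) ≈M diagonal (r * r′) (s * s′)
  diagonal-· r s r′ s′ = +-eliminateʳ refl (zeroʳ 0#) , +-eliminateʳ (zeroʳ r) (zeroˡ s′) ,
                         +-eliminateˡ (zeroˡ r′) (zeroʳ s) , +-eliminateˡ (zeroʳ 0#) refl

  Swap-· : (Swap · Swap) ≈M Id
  Swap-· = 0*x+1*y≈y 0# 1# , 0*x+1*y≈y 1# 0# , 1*x+0*y≈x 0# 1# , 1*x+0*y≈x 1# 0#

  GL₂-upper : ∀ x → GL₂ (upper x)
  GL₂-upper x = GL₂-intro (upper (- x))
    (≈M.trans (upper-· x (- x)) (refl , -‿inverseˡ x , refl , refl))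
    (≈M.trans (upper-· (- x) x) (refl , -‿inverseʳ x , refl , refl))

  GL₂-lower : ∀ x → GL₂ (lower x)
  GL₂-lower x = GL₂-intro (lower (- x))
    (≈M.trans (lower-· x (- x)) (refl , refl , -‿inverseʳ x , refl))
    (≈M.trans (lower-· (- x) x) (refl , refl , -‿inverseˡ x , refl))

  GL₂-diagonal : ∀ {r s} → IsUnit r → IsUnit s → GL₂ (diagonal r s)
  GL₂-diagonal {r} {s} (r′ , rr′≈1 , r′r≈1) (s′ , ss′≈1 , s′s≈1) = GL₂-intro (diagonal r′ s′)
    (≈M.trans (diagonal-· r s r′ s′) (rr′≈1 , refl , refl , ss′≈1))
    (≈M.trans (diagonal-· r′ s′ r s) (r′r≈1 , refl , refl , s′s≈1))

  GL₂-Swap : GL₂ Swap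
  GL₂-Swap = GL₂-intro Swap Swap-· Swap-·

module ProjectiveLine {c ℓ} (R : Ring c ℓ) where
  open Ring R
  open ChainGeometry R
  open Matrices R public
  open import Relation.Binary.Reasoning.Setoid setoid
  open import Algebra.Properties.Ring R using (-0#≈0#)

  ≈P-isEquivalence : IsEquivalence _≈P_
  ≈P-isEquivalence = record
    { refl = refl , refl
    ; sym = λ (a , b) → sym a , sym b
    ; trans = λ (a , b) (a′ , b′) → trans a a′ , trans b b′
    }

  module ≈P = IsEquivalence ≈P-isEquivalence

  ⋆-cong : ∀ {p p′ g g′} → p ≈P p′ → g ≈M g′ → (p ⋆ g) ≈P (p′ ⋆ g′)
  ⋆-cong (a , b) (g₁ , g₂ , g₃ , g₄) = +-cong (*-cong a g₁) (*-cong b g₃) , +-cong (*-cong a g₂) (*-cong b g₄)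

  ⋆-assoc : ∀ p g h → ((p ⋆ g) ⋆ h) ≈P (p ⋆ (g · h))
  ⋆-assoc (a , b) (mat g₁ g₂ g₃ g₄) (mat h₁ h₂ h₃ h₄) =
    dot-assoc a g₁ b g₃ h₁ g₂ g₄ h₃ , dot-assoc a g₁ b g₃ h₂ g₂ g₄ h₄

  ⋆-identityʳ : ∀ p → (p ⋆ Id) ≈P p
  ⋆-identityʳ (a , b) = x*1+y*0≈x a b , x*0+y*1≈y a b

  ⋆-cancelʳ : ∀ p {g h} → (g · h) ≈M Id → ((p ⋆ g) ⋆ h) ≈P p
  ⋆-cancelʳ p {g} {h} gh≈1 = ≈P.trans (⋆-assoc p g h) (≈P.trans (⋆-cong ≈P.refl gh≈1) (⋆-identityʳ p))

  row : Pair → Pair → Mat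
  row (a , b) (x , y) = mat a b x y

  e₁ e₂ : Pair
  e₁ = 1# , 0#
  e₂ = 0# , 1#

  e₁⋆row : ∀ x y → (e₁ ⋆ row x y) ≈P x
  e₁⋆row (a , b) (x , y) = 1*x+0*y≈x a x , 1*x+0*y≈x b y

  e₂⋆row : ∀ x y → (e₂ ⋆ row x y) ≈P y
  e₂⋆row (a , b) (x , y) = 0*x+1*y≈y a x , 0*x+1*y≈y b y

  scale : Carrier → Pair → Pair
  scale r (a , b) = r * a , r * b

  scale-cong : ∀ {r r′ p p′} → r ≈ r′ → p ≈P p′ → scale r p ≈P scale r′ p′
  scale-cong r≈r′ (a , b) = *-cong r≈r′ a , *-cong r≈r′ b

  scale-assoc : ∀ r s p → scale r (scale s p) ≈P scale (r * s) p
  scale-assoc r s (a , b) = sym (*-assoc r s a) , sym (*-assoc r s b)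

  scale-identity : ∀ p → scale 1# p ≈P p
  scale-identity (a , b) = *-identityˡ a , *-identityˡ b

  scale-⋆ : ∀ r p g → scale r (p ⋆ g) ≈P (scale r p ⋆ g)
  scale-⋆ r (a , b) g = *-distribˡ-+-assoc r a b _ _ , *-distribˡ-+-assoc r a b _ _

  samePoint-isEquivalence : IsEquivalence SamePoint
  samePoint-isEquivalence = record
    { refl = (λ _ z∈p → z∈p) , (λ _ z∈p → z∈p)
    ; sym = λ (p⊆p′ , p′⊆p) → p′⊆p , p⊆p′
    ; trans = λ (p⊆p′ , p′⊆p) (p′⊆p″ , p″⊆p′) →
        (λ z → p′⊆p″ z ∘ p⊆p′ z) , (λ z → p′⊆p z ∘ p″⊆p′ z)
    }

  module SP = IsEquivalence samePoint-isEquivalence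

  private
    ∈R⇒scale : ∀ {z} p → z ∈R p → ∃ λ r → z ≈P scale r p
    ∈R⇒scale (a , b) z∈p = z∈p

    scale⇒∈R : ∀ {z} p r → z ≈P scale r p → z ∈R p
    scale⇒∈R (a , b) r z≈rp = r , z≈rp

  samePoint-scale : ∀ {x y} r s → x ≈P scale r y → y ≈P scale s x → SamePoint x y
  samePoint-scale {x} {y} r s x≈ry y≈sx =
    (λ z z∈x → let (t , z≈tx) = ∈R⇒scale x z∈x in
       scale⇒∈R y (t * r) (≈P.trans z≈tx (≈P.trans (scale-cong refl x≈ry) (scale-assoc t r y)))) ,
    (λ z z∈y → let (t , z≈ty) = ∈R⇒scale y z∈y in
       scale⇒∈R x (t * s) (≈P.trans z≈ty (≈P.trans (scale-cong refl y≈sx) (scale-assoc t s x))))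

  ≈P⇒samePoint : ∀ {x y} → x ≈P y → SamePoint x y
  ≈P⇒samePoint {x} {y} x≈y = samePoint-scale 1# 1#
    (≈P.trans x≈y (≈P.sym (scale-identity y))) (≈P.trans (≈P.sym x≈y) (≈P.sym (scale-identity x)))

  samePoint⇒scale : ∀ {x y} → SamePoint x y → ∃ λ r → y ≈P scale r x
  samePoint⇒scale {x} {y} (_ , y⊆x) = ∈R⇒scale x (y⊆x y (scale⇒∈R y 1# (≈P.sym (scale-identity y))))

  samePoint-⋆ : ∀ {x y} g → SamePoint x y → SamePoint (x ⋆ g) (y ⋆ g)
  samePoint-⋆ {x} {y} g x~y =
    let (r , y≈rx) = samePoint⇒scale x~y ; (s , x≈sy) = samePoint⇒scale (SP.sym x~y) in
    samePoint-scale s r (≈P.trans (⋆-cong x≈sy ≈M.refl) (≈P.sym (scale-⋆ s y g)))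
                        (≈P.trans (⋆-cong y≈rx ≈M.refl) (≈P.sym (scale-⋆ r x g)))

  samePoint-unitScale : ∀ {α p} → IsUnit α → SamePoint (scale α p) p
  samePoint-unitScale {α} {p} (α′ , _ , α′α≈1) = samePoint-scale α α′ ≈P.refl
    (≈P.trans (≈P.sym (scale-identity p)) (≈P.trans (scale-cong (sym α′α≈1) ≈P.refl) (≈P.sym (scale-assoc α′ α p))))

  admissible-⋆ : ∀ {x g} → GL₂ g → Admissible x → Admissible (x ⋆ g)
  admissible-⋆ {x} {g} G (x′ , y′ , X) = let (u , v) = (x′ , y′) ⋆ g in u , v , GL₂-· X G

  admissible-[1,a] : ∀ a → Admissible (1# , a)
  admissible-[1,a] a = 0# , 1# , GL₂-upper a

  admissible-e₂ : Admissible e₂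
  admissible-e₂ = 1# , 0# , GL₂-Swap

  scale-fixes-admissible⇒≈1 : ∀ {x} t → Admissible x → x ≈P scale t x → t ≈ 1#
  scale-fixes-admissible⇒≈1 {a , b} t (_ , _ , X) (a≈ta , b≈tb) = begin
    t                                 ≈⟨ *-identityʳ t ⟨
    t * 1#                            ≈⟨ *-congˡ (proj₁ (·-inverseʳ X)) ⟨
    t * (a * m11 h + b * m21 h)       ≈⟨ *-distribˡ-+-assoc t a b _ _ ⟩
    (t * a) * m11 h + (t * b) * m21 h ≈⟨ +-cong (*-congʳ a≈ta) (*-congʳ b≈tb) ⟨
    a * m11 h + b * m21 h             ≈⟨ proj₁ (·-inverseʳ X) ⟩
    1#                                ∎
    where
      h : Mat
      h = inverse X

  samePoint⇒unitScale : ∀ {x x′} → Admissible x → Admissible x′ → SamePoint x x′ →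
    ∃ λ u → IsUnit u × x′ ≈P scale u x
  samePoint⇒unitScale {x} {x′} X X′ x~x′ with samePoint⇒scale x~x′ | samePoint⇒scale (SP.sym x~x′)
  ... | r , x′≈rx | s , x≈sx′ = r , (s , rs≈1 , sr≈1) , x′≈rx
    where
      rs≈1 : r * s ≈ 1#
      rs≈1 = scale-fixes-admissible⇒≈1 (r * s) X′
               (≈P.trans x′≈rx (≈P.trans (scale-cong refl x≈sx′) (scale-assoc r s x′)))
      sr≈1 : s * r ≈ 1#
      sr≈1 = scale-fixes-admissible⇒≈1 (s * r) X
               (≈P.trans x≈sx′ (≈P.trans (scale-cong refl x′≈rx) (scale-assoc s r x)))

  distant-resp-≈P : ∀ {x y x′ y′} → x ≈P x′ → y ≈P y′ → Distant x y → Distant x′ y′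
  distant-resp-≈P (a , b) (c , d) = GL₂-resp (a , b , c , d)

  distant-⋆ : ∀ {x y g} → GL₂ g → Distant x y → Distant (x ⋆ g) (y ⋆ g)
  distant-⋆ G D = GL₂-· D G

  distant-sym : ∀ {x y} → Distant x y → Distant y x
  distant-sym {x} {y} D = GL₂-resp (0*x+1*y≈y _ _ , 0*x+1*y≈y _ _ , 1*x+0*y≈x _ _ , 1*x+0*y≈x _ _) (GL₂-· GL₂-Swap D)

  distant⇒admissibleˡ : ∀ {x y} → Distant x y → Admissible x
  distant⇒admissibleˡ {y = y′ , y″} D = y′ , y″ , D

  distant⇒admissibleʳ : ∀ {x y} → Distant x y → Admissible y
  distant⇒admissibleʳ D = distant⇒admissibleˡ (distant-sym D)

  distant-respˡ-samePoint : ∀ {x x′ y} → Admissible x′ → SamePoint x x′ → Distant x y → Distant x′ y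
  distant-respˡ-samePoint {x} {x′} {y} X′ x~x′ D with samePoint⇒unitScale (distant⇒admissibleˡ D) X′ x~x′
  ... | u , U , x′≈ux = distant-resp-≈P (≈P.sym x′≈ux) ≈P.refl
    (GL₂-resp (diagonal-row u x y) (GL₂-· (GL₂-diagonal U (1# , *-identityˡ 1# , *-identityˡ 1#)) D))
    where
      diagonal-row : ∀ u x y → (diagonal u 1# · row x y) ≈M row (scale u x) y
      diagonal-row u (a , b) (c , d) = +-eliminateʳ refl (zeroˡ c) , +-eliminateʳ refl (zeroˡ d) ,
                                       0*x+1*y≈y a c , 0*x+1*y≈y b d

  distant-respʳ-samePoint : ∀ {x y y′} → Admissible y′ → SamePoint y y′ → Distant x y → Distant x y′
  distant-respʳ-samePoint Y′ y~y′ D = distant-sym (distant-respˡ-samePoint Y′ y~y′ (distant-sym D))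

  distant-transfer : ∀ {g x y s t} → GL₂ g → Admissible x → Admissible y → SamePoint (s ⋆ g) x → SamePoint (t ⋆ g) y →
    Distant s t → Distant x y
  distant-transfer G X Y s⋆g~x t⋆g~y D =
    distant-respʳ-samePoint Y t⋆g~y (distant-respˡ-samePoint X s⋆g~x (distant-⋆ G D))

  distant⇒¬samePoint : ¬ 1# ≈ 0# → ∀ {x y} → Distant x y → ¬ SamePoint x y
  distant⇒¬samePoint 1≉0 {a , b} {c , d} D x~y with samePoint⇒scale x~y | ·-inverseʳ D
  ... | r , c≈ra , d≈rb | _ , m₁₂≈0 , _ , m₂₂≈1 = 1≉0 (begin
    1#                                ≈⟨ m₂₂≈1 ⟨
    c * m12 h + d * m22 h             ≈⟨ +-cong (*-congʳ c≈ra) (*-congʳ d≈rb) ⟩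
    (r * a) * m12 h + (r * b) * m22 h ≈⟨ *-distribˡ-+-assoc r a b _ _ ⟨
    r * (a * m12 h + b * m22 h)       ≈⟨ *-congˡ m₁₂≈0 ⟩
    r * 0#                            ≈⟨ zeroʳ r ⟩
    0#                                ∎)
    where
      h : Mat
      h = inverse D

  distant-e₂⇒unitˡ : ∀ {a b} → Distant e₂ (a , b) → IsUnit a
  distant-e₂⇒unitˡ {a} {b} D with ·-inverseʳ D | ·-inverseˡ D
  ... | _ , m₁₂≈0 , _ , m₂₂≈1 | m₁₁≈1 , _ = m12 h , (begin
    a * m12 h             ≈⟨ +-eliminateʳ refl (trans (*-congˡ h₂₂≈0) (zeroʳ b)) ⟨
    a * m12 h + b * m22 h ≈⟨ m₂₂≈1 ⟩
    1#                    ∎) , trans (sym (+-eliminateˡ (zeroʳ _) refl)) m₁₁≈1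
    where
      h : Mat
      h = inverse D
      h₂₂≈0 : m22 h ≈ 0#
      h₂₂≈0 = trans (sym (0*x+1*y≈y _ _)) m₁₂≈0

  distant-e₁⇒unitʳ : ∀ {a b} → Distant e₁ (a , b) → IsUnit b
  distant-e₁⇒unitʳ {a} {b} D with ·-inverseʳ D | ·-inverseˡ D
  ... | _ , m₁₂≈0 , _ , m₂₂≈1 | _ , _ , _ , m₂₂′≈1 = m22 h , (begin
    b * m22 h             ≈⟨ +-eliminateˡ (trans (*-congˡ h₁₂≈0) (zeroʳ a)) refl ⟨
    a * m12 h + b * m22 h ≈⟨ m₂₂≈1 ⟩
    1#                    ∎) , trans (sym (+-eliminateˡ (zeroʳ _) refl)) m₂₂′≈1
    where
      h : Mat
      h = inverse D
      h₁₂≈0 : m12 h ≈ 0#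
      h₁₂≈0 = trans (sym (1*x+0*y≈x _ _)) m₁₂≈0

  distant-[1,a]-e₂ : ∀ a → Distant (1# , a) e₂
  distant-[1,a]-e₂ = GL₂-upper

  distant-[1,a]-[1,b] : ∀ {a b} → IsUnit (b - a) → Distant (1# , a) (1# , b)
  distant-[1,a]-[1,b] {a} {b} U =
    GL₂-resp (≈M.trans (·-cong (≈M.refl {lower 1#}) factor₁) factor₂)
             (GL₂-· (GL₂-lower 1#) (GL₂-· (GL₂-diagonal (1# , *-identityʳ 1# , *-identityʳ 1#) U) (GL₂-upper a)))
    where
      factor₁ : (diagonal 1# (b - a) · upper a) ≈M mat 1# a 0# (b - a)
      factor₁ = +-eliminateʳ (*-identityˡ 1#) (zeroʳ 0#) , +-eliminateʳ (*-identityˡ a) (zeroˡ 1#) ,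
                +-eliminateˡ (zeroˡ 1#) (zeroʳ _) , +-eliminateˡ (zeroˡ a) (*-identityʳ _)
      factor₂ : (lower 1# · mat 1# a 0# (b - a)) ≈M mat 1# a 1# b
      factor₂ = +-eliminateʳ (*-identityˡ 1#) (zeroˡ 0#) , +-eliminateʳ (*-identityˡ a) (zeroˡ _) ,
                +-eliminateʳ (*-identityˡ 1#) (zeroʳ 1#) , trans (+-cong (*-identityˡ a) (*-identityˡ _)) (begin
        a + (b - a)   ≈⟨ +-congˡ (+-comm b (- a)) ⟩
        a + (- a + b) ≈⟨ +-assoc a (- a) b ⟨
        (a - a) + b   ≈⟨ +-eliminateˡ (-‿inverseʳ a) refl ⟩
        b             ∎)

  [1,a]-injective : ∀ {a b} → SamePoint (1# , a) (1# , b) → a ≈ b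
  [1,a]-injective {a} x~y with samePoint⇒scale x~y
  ... | r , 1≈r1 , b≈ra = sym (trans b≈ra (trans (*-congʳ r≈1) (*-identityˡ a)))
    where
      r≈1 : r ≈ 1#
      r≈1 = trans (sym (*-identityʳ r)) (sym 1≈r1)

  [1,a]≁e₂ : ¬ 1# ≈ 0# → ∀ {a} → ¬ SamePoint (1# , a) e₂
  [1,a]≁e₂ 1≉0 {a} x~e₂ with samePoint⇒scale x~e₂
  ... | r , 0≈r1 , 1≈ra = 1≉0 (begin
    1#     ≈⟨ 1≈ra ⟩
    r * a  ≈⟨ *-congʳ (trans (sym (*-identityʳ r)) (sym 0≈r1)) ⟩
    0# * a ≈⟨ zeroˡ a ⟩
    0#     ∎)

  distant-e₂⇒samePoint-[1,a] : ∀ {a b} → Distant e₂ (a , b) → ∃ λ a′ → IsUnit a′ × SamePoint (1# , a′ * b) (a , b)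
  distant-e₂⇒samePoint-[1,a] {a} {b} D with distant-e₂⇒unitˡ D
  ... | a′ , aa′≈1 , a′a≈1 = a′ , (a , a′a≈1 , aa′≈1) ,
    samePoint-scale a′ a (sym a′a≈1 , refl) (sym (*-identityʳ a) , sym (begin
      a * (a′ * b) ≈⟨ *-assoc a a′ b ⟨
      (a * a′) * b ≈⟨ *-congʳ aa′≈1 ⟩
      1# * b       ≈⟨ *-identityˡ b ⟩
      b            ∎))

  distant-carry : ∀ {g e p x} → GL₂ g → (e ⋆ g) ≈P p → Distant e x → Distant p (x ⋆ g)
  distant-carry G e⋆g≈p D = distant-resp-≈P e⋆g≈p ≈P.refl (distant-⋆ G D)

  distant-uncarry : ∀ {g e p y} (G : GL₂ g) → (e ⋆ g) ≈P p → Distant p y → Distant e (y ⋆ inverse G)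
  distant-uncarry {e = e} G e⋆g≈p D =
    distant-resp-≈P (≈P.trans (⋆-cong (≈P.sym e⋆g≈p) ≈M.refl) (⋆-cancelʳ e (·-inverseʳ G))) ≈P.refl
                    (distant-⋆ (GL₂-inverse G) D)

  card-points-⋆ : ∀ {x₁ x₂} {X : Pair → Set x₁} {Y : Pair → Set x₂} {n g} (G : GL₂ g) →
    Card SamePoint (λ x → Admissible x × X x) n →
    (∀ {x} → Admissible x → X x → Y (x ⋆ g)) → (∀ {y} → Admissible y → Y y → X (y ⋆ inverse G)) →
    Card SamePoint (λ y → Admissible y × Y y) n
  card-points-⋆ {g = g} G C X⇒Y Y⇒X = card-image samePoint-isEquivalence (_⋆ g) C
    (λ (A , x) → admissible-⋆ G A , X⇒Y A x)
    (λ _ _ → samePoint-⋆ g)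
    (λ {x} {y} _ _ x⋆g~y⋆g → SP.trans (≈P⇒samePoint (≈P.sym (⋆-cancelʳ x (·-inverseʳ G))))
                               (SP.trans (samePoint-⋆ (inverse G) x⋆g~y⋆g) (≈P⇒samePoint (⋆-cancelʳ y (·-inverseʳ G)))))
    (λ y (A , Yy) → y ⋆ inverse G , (admissible-⋆ (GL₂-inverse G) A , Y⇒X A Yy) ,
                    ≈P⇒samePoint (⋆-cancelʳ y (·-inverseˡ G)))

  points-distant-from-e₂ : ∀ {N} → Card _≈_ Everything N → Card SamePoint (λ x → Admissible x × Distant e₂ x) N
  points-distant-from-e₂ C = card-image samePoint-isEquivalence (1# ,_) C
    (λ {a} _ → admissible-[1,a] a , distant-sym (distant-[1,a]-e₂ a))
    (λ _ _ a≈b → ≈P⇒samePoint (refl , a≈b))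
    (λ _ _ → [1,a]-injective)
    (λ (_ , b) (_ , D) → let (a′ , _ , [1,a′b]~y) = distant-e₂⇒samePoint-[1,a] D in a′ * b , lift _ , [1,a′b]~y)

  points-distant-from-e₁-e₂ : ∀ {r} → Card _≈_ IsUnit r →
    Card SamePoint (λ x → Admissible x × (Distant e₁ x × Distant e₂ x)) r
  points-distant-from-e₁-e₂ C = card-image samePoint-isEquivalence (1# ,_) C
    (λ {u} U → admissible-[1,a] u , distant-[1,a]-[1,b] (isUnit-resp (sym u-0≈u) U) , distant-sym (distant-[1,a]-e₂ u))
    (λ _ _ a≈b → ≈P⇒samePoint (refl , a≈b))
    (λ _ _ → [1,a]-injective)
    (λ (_ , b) (_ , D₁ , D₂) → let (a′ , A′ , [1,a′b]~y) = distant-e₂⇒samePoint-[1,a] D₂ in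
                                a′ * b , isUnit-* A′ (distant-e₁⇒unitʳ D₁) , [1,a′b]~y)
    where
      u-0≈u : ∀ {u} → u - 0# ≈ u
      u-0≈u = +-eliminateʳ refl -0#≈0#

  points-distant-from : ∀ {N p} → Admissible p → Card _≈_ Everything N →
    Card SamePoint (λ y → Admissible y × Distant p y) N
  points-distant-from {p = p} (x , y , P) C =
    card-points-⋆ G (points-distant-from-e₂ C) (λ _ → distant-carry G e₂⋆g≈p) (λ _ → distant-uncarry G e₂⋆g≈p)
    where
      G : GL₂ (Swap · row p (x , y))
      G = GL₂-· GL₂-Swap P
      e₂⋆g≈p : (e₂ ⋆ (Swap · row p (x , y))) ≈P p
      e₂⋆g≈p = ≈P.trans (≈P.sym (⋆-assoc e₂ Swap (row p (x , y))))
                 (≈P.trans (⋆-cong (0*x+1*y≈y 0# 1# , 0*x+1*y≈y 1# 0#) ≈M.refl) (e₁⋆row p (x , y)))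

  points-distant-from-both : ∀ {r p₁ p₂} → Distant p₁ p₂ → Card _≈_ IsUnit r →
    Card SamePoint (λ y → Admissible y × (Distant p₁ y × Distant p₂ y)) r
  points-distant-from-both {p₁ = p₁} {p₂} D C = card-points-⋆ D (points-distant-from-e₁-e₂ C)
    (λ _ (D₁ , D₂) → distant-carry D (e₁⋆row p₁ p₂) D₁ , distant-carry D (e₂⋆row p₁ p₂) D₂)
    (λ _ (D₁ , D₂) → distant-uncarry D (e₁⋆row p₁ p₂) D₁ , distant-uncarry D (e₂⋆row p₁ p₂) D₂)

  samePoint-relay : ∀ {k l e x y} (K : GL₂ k) → SamePoint (e ⋆ k) x → SamePoint (e ⋆ l) y →
    SamePoint (x ⋆ (inverse K · l)) y
  samePoint-relay {k} {l} {e} K e⋆k~x e⋆l~y = SP.trans (samePoint-⋆ (inverse K · l) (SP.sym e⋆k~x))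
    (SP.trans (≈P⇒samePoint (≈P.trans (≈P.sym (⋆-assoc (e ⋆ k) (inverse K) l))
                                      (⋆-cong (⋆-cancelʳ e (·-inverseʳ K)) ≈M.refl)))
              e⋆l~y)

  -- The frame is diagonal α β · row p₁ p₂, where (α , β) are the coordinates of w in the basis (p₁ , p₂);
  -- they are units because w is distant from p₂ and from p₁.
  distant-triple-frame : ∀ {p₁ p₂ w} → Distant p₁ p₂ → Distant p₁ w → Distant p₂ w →
    ∃ λ k → GL₂ k × SamePoint (e₁ ⋆ k) p₁ × SamePoint (e₂ ⋆ k) p₂ × SamePoint ((1# , 1#) ⋆ k) w
  distant-triple-frame {p₁} {p₂} {w} D₁₂ D₁ D₂ =
    diagonal α β · M , GL₂-· (GL₂-diagonal A B) D₁₂ ,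
    scaled-row A e₁⋆D (e₁⋆row p₁ p₂) , scaled-row B e₂⋆D (e₂⋆row p₁ p₂) ,
    ≈P⇒samePoint (≈P.trans (≈P.sym (⋆-assoc (1# , 1#) (diagonal α β) M))
                   (≈P.trans (⋆-cong [1,1]⋆D ≈M.refl) (⋆-cancelʳ w (·-inverseˡ D₁₂))))
    where
      M : Mat
      M = row p₁ p₂
      α β : Carrier
      α = proj₁ (w ⋆ inverse D₁₂)
      β = proj₂ (w ⋆ inverse D₁₂)
      A : IsUnit α
      A = distant-e₂⇒unitˡ (distant-uncarry D₁₂ (e₂⋆row p₁ p₂) D₂)
      B : IsUnit β
      B = distant-e₁⇒unitʳ (distant-uncarry D₁₂ (e₁⋆row p₁ p₂) D₁)
      e₁⋆D : (e₁ ⋆ diagonal α β) ≈P scale α e₁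
      e₁⋆D = trans (1*x+0*y≈x α 0#) (sym (*-identityʳ α)) , trans (1*x+0*y≈x 0# β) (sym (zeroʳ α))
      e₂⋆D : (e₂ ⋆ diagonal α β) ≈P scale β e₂
      e₂⋆D = trans (0*x+1*y≈y α 0#) (sym (zeroʳ β)) , trans (0*x+1*y≈y 0# β) (sym (*-identityʳ β))
      [1,1]⋆D : ((1# , 1#) ⋆ diagonal α β) ≈P (w ⋆ inverse D₁₂)
      [1,1]⋆D = +-eliminateʳ (*-identityˡ α) (*-identityˡ 0#) , +-eliminateˡ (*-identityˡ 0#) (*-identityˡ β)
      scaled-row : ∀ {γ e p} → IsUnit γ → (e ⋆ diagonal α β) ≈P scale γ e → (e ⋆ M) ≈P p →
        SamePoint (e ⋆ (diagonal α β · M)) p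
      scaled-row {γ} {e} Γ e⋆D≈γe e⋆M≈p = SP.trans
        (≈P⇒samePoint (≈P.trans (≈P.sym (⋆-assoc e (diagonal α β) M))
          (≈P.trans (⋆-cong e⋆D≈γe ≈M.refl) (≈P.trans (≈P.sym (scale-⋆ γ e M)) (scale-cong refl e⋆M≈p)))))
        (samePoint-unitScale Γ)

module Chains {c ℓ} (R : Ring c ℓ) (1≉0 : ¬ Ring._≈_ R (Ring.1# R) (Ring.0# R))
  (F : ChainGeometry.Subfield R) (_≟_ : Decidable (Ring._≈_ R)) where
  open Ring R
  open ChainGeometry R
  open Subfield F
  open ProjectiveLine R public
  open import Relation.Binary.Reasoning.Setoid setoid
  open import Algebra.Properties.Ring R using (x∙y⁻¹≈ε⇒x≈y)
  open import Data.Nat using (suc)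

  inF-inverse : ∀ {a} → inF a → ¬ a ≈ 0# → ∃ λ e → inF e × a * e ≈ 1# × e * a ≈ 1#
  inF-inverse a∈F a≉0 with inF-inv a∈F a≉0
  ... | e , e∈F , ae≈1 = e , e∈F , ae≈1 , trans (inF-comm e∈F a∈F) ae≈1

  admissibleIn-[1,a] : ∀ {a} → inF a → AdmissibleIn inF (1# , a)
  admissibleIn-[1,a] {a} a∈F = 0# , 1# , (inF-1 , a∈F , inF-0 , inF-1) ,
    upper (- a) , (inF-1 , inF-neg a∈F , inF-0 , inF-1) , ·-inverseʳ (GL₂-upper a) , ·-inverseˡ (GL₂-upper a)

  admissibleIn-e₂ : AdmissibleIn inF e₂
  admissibleIn-e₂ = 1# , 0# , (inF-0 , inF-1 , inF-1 , inF-0) , Swap , (inF-0 , inF-1 , inF-1 , inF-0) , Swap-· , Swap-·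

  invertible⇒row≉0 : ∀ {S a b x y} → InvertibleIn S (mat a b x y) → a ≈ 0# → ¬ b ≈ 0#
  invertible⇒row≉0 (_ , _ , _ , (ah₁₁+bh₂₁≈1 , _) , _) a≈0 b≈0 =
    1≉0 (trans (sym ah₁₁+bh₂₁≈1) (+-eliminateˡ (trans (*-congʳ a≈0) (zeroˡ _)) (trans (*-congʳ b≈0) (zeroˡ _))))

  admissibleIn-normalForm : ∀ {u} → AdmissibleIn inF u → SamePoint u e₂ ⊎ ∃ λ a → inF a × SamePoint u (1# , a)
  admissibleIn-normalForm {a , b} (_ , _ , U@((a∈F , b∈F , _) , _)) with a ≟ 0#
  ... | yes a≈0 with inF-inverse b∈F (invertible⇒row≉0 U a≈0)
  ...   | e , _ , _ , eb≈1 = inj₁ (samePoint-scale b e (trans a≈0 (sym (zeroʳ b)) , sym (*-identityʳ b))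
                                                       (sym (trans (*-congˡ a≈0) (zeroʳ e)) , sym eb≈1))
  admissibleIn-normalForm {a , b} (_ , _ , ((a∈F , b∈F , _) , _)) | no a≉0 with inF-inverse a∈F a≉0
  ...   | e , e∈F , ae≈1 , ea≈1 = inj₂ (e * b , inF-* e∈F b∈F ,
           samePoint-scale a e (sym (*-identityʳ a) , sym (begin
             a * (e * b) ≈⟨ *-assoc a e b ⟨
             (a * e) * b ≈⟨ *-congʳ ae≈1 ⟩
             1# * b      ≈⟨ *-identityˡ b ⟩
             b           ∎)) (sym ea≈1 , refl))

  onChain-resp-samePoint : ∀ {C p p′} → SamePoint p p′ → OnChain F C p → OnChain F C p′
  onChain-resp-samePoint p~p′ (u , U , u⋆C~p) = u , U , SP.trans u⋆C~p p~p′

  onChain-resp-≈M : ∀ {C C′ p} → C ≈M C′ → OnChain F C p → OnChain F C′ p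
  onChain-resp-≈M C≈C′ (u , U , u⋆C~p) = u , U , SP.trans (≈P⇒samePoint (⋆-cong ≈P.refl (≈M.sym C≈C′))) u⋆C~p

  onChain-⋆ : ∀ {C p} g → OnChain F C p → OnChain F (C · g) (p ⋆ g)
  onChain-⋆ {C} g (u , U , u⋆C~p) = u , U , SP.trans (≈P⇒samePoint (≈P.sym (⋆-assoc u C g))) (samePoint-⋆ g u⋆C~p)

  onChain-carry : ∀ {g e p C} → SamePoint (e ⋆ g) p → OnChain F C e → OnChain F (C · g) p
  onChain-carry {g} e⋆g~p = onChain-resp-samePoint e⋆g~p ∘ onChain-⋆ g

  onChain-uncarry : ∀ {g e p C} (G : GL₂ g) → SamePoint (e ⋆ g) p → OnChain F C p → OnChain F (C · inverse G) e
  onChain-uncarry {e = e} G e⋆g~p = onChain-carry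
    (SP.trans (samePoint-⋆ (inverse G) (SP.sym e⋆g~p)) (≈P⇒samePoint (⋆-cancelʳ e (·-inverseʳ G))))

  onChain-sameChain : ∀ {C C′ p} → SameChain F C C′ → Admissible p → OnChain F C p → OnChain F C′ p
  onChain-sameChain C≡C′ P = Equivalence.to (C≡C′ _ P)

  sameChain-isEquivalence : IsEquivalence (SameChain F)
  sameChain-isEquivalence = record
    { refl = λ _ _ → mk⇔ id id
    ; sym = λ C≡C′ p P → mk⇔ (Equivalence.from (C≡C′ p P)) (Equivalence.to (C≡C′ p P))
    ; trans = λ C≡C′ C′≡C″ p P → mk⇔ (Equivalence.to (C′≡C″ p P) ∘ Equivalence.to (C≡C′ p P))
                                      (Equivalence.from (C≡C′ p P) ∘ Equivalence.from (C′≡C″ p P))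
    }

  module SC = IsEquivalence sameChain-isEquivalence

  sameChain-≈M : ∀ {C C′} → C ≈M C′ → SameChain F C C′
  sameChain-≈M C≈C′ _ _ = mk⇔ (onChain-resp-≈M C≈C′) (onChain-resp-≈M (≈M.sym C≈C′))

  sameChain-· : ∀ {C C′ g} → GL₂ g → SameChain F C C′ → SameChain F (C · g) (C′ · g)
  sameChain-· G C≡C′ p P = mk⇔ (move C≡C′) (move (SC.sym C≡C′))
    where
      move : ∀ {C C′} → SameChain F C C′ → OnChain F (C · _) p → OnChain F (C′ · _) p
      move {C} C≡C′ p∈Cg = onChain-carry (≈P⇒samePoint (⋆-cancelʳ p (·-inverseˡ G)))
        (onChain-sameChain C≡C′ (admissible-⋆ (GL₂-inverse G) P)
          (onChain-resp-≈M (·-cancelʳ C (·-inverseʳ G)) (onChain-⋆ (inverse G) p∈Cg)))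

  sameChain-cancelʳ : ∀ {C C′ g} → GL₂ g → SameChain F (C · g) (C′ · g) → SameChain F C C′
  sameChain-cancelʳ {C} {C′} G Cg≡C′g = SC.trans (sameChain-≈M (≈M.sym (·-cancelʳ C (·-inverseʳ G))))
    (SC.trans (sameChain-· (GL₂-inverse G) Cg≡C′g) (sameChain-≈M (·-cancelʳ C′ (·-inverseʳ G))))

  card-chains-· : ∀ {x₁ x₂} {X : Mat → Set x₁} {Y : Mat → Set x₂} {n g} (G : GL₂ g) →
    Card (SameChain F) (λ C → GL₂ C × X C) n →
    (∀ {C} → GL₂ C → X C → Y (C · g)) → (∀ {C} → GL₂ C → Y C → X (C · inverse G)) →
    Card (SameChain F) (λ C → GL₂ C × Y C) n
  card-chains-· {g = g} G Cd X⇒Y Y⇒X = card-image sameChain-isEquivalence (_· g) Cd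
    (λ (C , x) → GL₂-· C G , X⇒Y C x)
    (λ _ _ → sameChain-· G)
    (λ _ _ → sameChain-cancelʳ G)
    (λ C (C′ , y) → C · inverse G , (GL₂-· C′ (GL₂-inverse G) , Y⇒X C′ y) ,
                    sameChain-≈M (·-cancelʳ C (·-inverseˡ G)))

  onChain-normalForm : ∀ {C x} → OnChain F C x → SamePoint x (e₂ ⋆ C) ⊎ ∃ λ a → inF a × SamePoint x ((1# , a) ⋆ C)
  onChain-normalForm {C} (u , U , u⋆C~x) with admissibleIn-normalForm U
  ... | inj₁ u~e₂ = inj₁ (SP.trans (SP.sym u⋆C~x) (samePoint-⋆ C u~e₂))
  ... | inj₂ (a , a∈F , u~[1,a]) = inj₂ (a , a∈F , SP.trans (SP.sym u⋆C~x) (samePoint-⋆ C u~[1,a]))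

  standardChain-points : ∀ {q} → Card _≈_ inF q → Card SamePoint (λ p → Admissible p × OnChain F Id p) (suc q)
  standardChain-points {q} C = card-insert samePoint-isEquivalence finitePoints
    (admissible-e₂ , e₂ , admissibleIn-e₂ , ≈P⇒samePoint (⋆-identityʳ e₂))
    (λ (P , a , a∈F , p~[1,a]) → P , (1# , a) , admissibleIn-[1,a] a∈F ,
                                 SP.trans (≈P⇒samePoint (⋆-identityʳ _)) (SP.sym p~[1,a]))
    (λ (_ , _ , _ , p~[1,a]) p~e₂ → [1,a]≁e₂ 1≉0 (SP.trans (SP.sym p~[1,a]) p~e₂))
    split
    where
      finitePoints : Card SamePoint (λ p → Admissible p × ∃ λ a → inF a × SamePoint p (1# , a)) q
      finitePoints = card-image samePoint-isEquivalence (1# ,_) C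
        (λ {a} a∈F → admissible-[1,a] a , a , a∈F , SP.refl)
        (λ _ _ a≈b → ≈P⇒samePoint (refl , a≈b))
        (λ _ _ → [1,a]-injective)
        (λ _ (_ , a , a∈F , p~[1,a]) → a , a∈F , SP.sym p~[1,a])
      split : ∀ p → Admissible p × OnChain F Id p → SamePoint p e₂ ⊎ Admissible p × ∃ λ a → inF a × SamePoint p (1# , a)
      split p (P , p∈Id) with onChain-normalForm p∈Id
      ... | inj₁ p~e₂ = inj₁ (SP.trans p~e₂ (≈P⇒samePoint (⋆-identityʳ e₂)))
      ... | inj₂ (a , a∈F , p~[1,a]) = inj₂ (P , a , a∈F , SP.trans p~[1,a] (≈P⇒samePoint (⋆-identityʳ _)))

  chain-points : ∀ {q C} → Card _≈_ inF q → GL₂ C → Card SamePoint (λ p → Admissible p × OnChain F C p) (suc q)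
  chain-points {C = C} Cq G = card-points-⋆ G (standardChain-points Cq)
    (λ _ → onChain-resp-≈M (·-identityˡ C) ∘ onChain-⋆ C)
    (λ _ → onChain-resp-≈M (·-inverseʳ G) ∘ onChain-⋆ (inverse G))

  inF-difference-isUnit : ∀ {a b} → inF a → inF b → ¬ a ≈ b → IsUnit (b - a)
  inF-difference-isUnit a∈F b∈F a≉b with inF-inverse (inF-+ b∈F (inF-neg a∈F)) (a≉b ∘ sym ∘ x∙y⁻¹≈ε⇒x≈y _ _)
  ... | e , _ , [b-a]e≈1 , e[b-a]≈1 = e , [b-a]e≈1 , e[b-a]≈1

  onChain-distant : ∀ {C x y} → GL₂ C → Admissible x → Admissible y → OnChain F C x → OnChain F C y →
    ¬ SamePoint x y → Distant x y
  onChain-distant {C} G X Y x∈C y∈C x≁y with onChain-normalForm x∈C | onChain-normalForm y∈C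
  ... | inj₁ x~∞ | inj₁ y~∞ = ⊥-elim (x≁y (SP.trans x~∞ (SP.sym y~∞)))
  ... | inj₁ x~∞ | inj₂ (b , _ , y~b) = distant-transfer G X Y (SP.sym x~∞) (SP.sym y~b) (distant-sym (distant-[1,a]-e₂ b))
  ... | inj₂ (a , _ , x~a) | inj₁ y~∞ = distant-transfer G X Y (SP.sym x~a) (SP.sym y~∞) (distant-[1,a]-e₂ a)
  ... | inj₂ (a , a∈F , x~a) | inj₂ (b , b∈F , y~b) with a ≟ b
  ...   | yes a≈b = ⊥-elim (x≁y (SP.trans x~a (SP.trans (≈P⇒samePoint (⋆-cong (refl , a≈b) ≈M.refl)) (SP.sym y~b))))
  ...   | no a≉b = distant-transfer G X Y (SP.sym x~a) (SP.sym y~b) (distant-[1,a]-[1,b] (inF-difference-isUnit a∈F b∈F a≉b))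

  chains-through-one-point : ∀ {n p₁ p} → Admissible p₁ → Admissible p →
    Card (SameChain F) (λ C → GL₂ C × OnChain F C p₁) n → Card (SameChain F) (λ C → GL₂ C × OnChain F C p) n
  chains-through-one-point {p₁ = p₁} {p} (x₁ , y₁ , K) (x , y , L) Cd =
    card-chains-· G Cd (λ _ → onChain-carry p₁↦p) (λ _ → onChain-uncarry G p₁↦p)
    where
      G : GL₂ (inverse K · row p (x , y))
      G = GL₂-· (GL₂-inverse K) L
      p₁↦p : SamePoint (p₁ ⋆ (inverse K · row p (x , y))) p
      p₁↦p = samePoint-relay K (≈P⇒samePoint (e₁⋆row p₁ (x₁ , y₁))) (≈P⇒samePoint (e₁⋆row p (x , y)))

  chains-through-two-points : ∀ {n p₁ p₂ p} → Distant p₁ p₂ → Distant p₁ p →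
    Card (SameChain F) (λ C → GL₂ C × OnChain F C p₁ × OnChain F C p₂) n →
    Card (SameChain F) (λ C → GL₂ C × OnChain F C p₁ × OnChain F C p) n
  chains-through-two-points {p₁ = p₁} {p₂} {p} K L Cd =
    card-chains-· G Cd (λ _ (p₁∈C , p₂∈C) → onChain-carry p₁↦p₁ p₁∈C , onChain-carry p₂↦p p₂∈C)
                       (λ _ (p₁∈C , p∈C) → onChain-uncarry G p₁↦p₁ p₁∈C , onChain-uncarry G p₂↦p p∈C)
    where
      G : GL₂ (inverse K · row p₁ p)
      G = GL₂-· (GL₂-inverse K) L
      p₁↦p₁ : SamePoint (p₁ ⋆ (inverse K · row p₁ p)) p₁
      p₁↦p₁ = samePoint-relay K (≈P⇒samePoint (e₁⋆row p₁ p₂)) (≈P⇒samePoint (e₁⋆row p₁ p))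
      p₂↦p : SamePoint (p₂ ⋆ (inverse K · row p₁ p)) p
      p₂↦p = samePoint-relay K (≈P⇒samePoint (e₂⋆row p₁ p₂)) (≈P⇒samePoint (e₂⋆row p₁ p))

  chains-through-three-points : ∀ {n p₁ p₂ p₃ p} → Distant p₁ p₂ → Distant p₁ p₃ → Distant p₂ p₃ →
    Distant p₁ p → Distant p₂ p →
    Card (SameChain F) (λ C → GL₂ C × OnChain F C p₁ × OnChain F C p₂ × OnChain F C p₃) n →
    Card (SameChain F) (λ C → GL₂ C × OnChain F C p₁ × OnChain F C p₂ × OnChain F C p) n
  chains-through-three-points {p₁ = p₁} {p₂} {p₃} {p} D₁₂ D₁₃ D₂₃ D₁ D₂ Cd
    with distant-triple-frame D₁₂ D₁₃ D₂₃ | distant-triple-frame D₁₂ D₁ D₂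
  ... | k , K , e₁↦p₁ , e₂↦p₂ , e↦p₃ | l , L , e₁↦p₁′ , e₂↦p₂′ , e↦p =
    card-chains-· G Cd
      (λ _ (p₁∈C , p₂∈C , p₃∈C) →
         onChain-carry p₁↦p₁ p₁∈C , onChain-carry p₂↦p₂ p₂∈C , onChain-carry p₃↦p p₃∈C)
      (λ _ (p₁∈C , p₂∈C , p∈C) →
         onChain-uncarry G p₁↦p₁ p₁∈C , onChain-uncarry G p₂↦p₂ p₂∈C , onChain-uncarry G p₃↦p p∈C)
    where
      G : GL₂ (inverse K · l)
      G = GL₂-· (GL₂-inverse K) L
      p₁↦p₁ : SamePoint (p₁ ⋆ (inverse K · l)) p₁
      p₁↦p₁ = samePoint-relay K e₁↦p₁ e₁↦p₁′
      p₂↦p₂ : SamePoint (p₂ ⋆ (inverse K · l)) p₂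
      p₂↦p₂ = samePoint-relay K e₂↦p₂ e₂↦p₂′
      p₃↦p : SamePoint (p₃ ⋆ (inverse K · l)) p
      p₃↦p = samePoint-relay K e↦p₃ e↦p

  chain-points-distant-from : ∀ {q C p₁} → Card _≈_ inF q → GL₂ C → Admissible p₁ → OnChain F C p₁ →
    Card SamePoint (λ p → Admissible p × OnChain F C p × Distant p₁ p) q
  chain-points-distant-from Cq G P₁ p₁∈C = card-cong samePoint-isEquivalence
    ((λ ((P , p∈C) , p≁p₁) → P , p∈C , distant-sym (onChain-distant G P P₁ p∈C p₁∈C p≁p₁)) ,
     (λ (P , p∈C , D) → (P , p∈C) , λ p~p₁ → distant⇒¬samePoint 1≉0 D (SP.sym p~p₁)))
    (card-remove samePoint-isEquivalence (chain-points Cq G) (P₁ , p₁∈C))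

  chain-points-distant-from-both : ∀ {q C p₁ p₂} → Card _≈_ inF (suc q) → GL₂ C → Distant p₁ p₂ →
    OnChain F C p₁ → OnChain F C p₂ →
    Card SamePoint (λ p → Admissible p × OnChain F C p × Distant p₁ p × Distant p₂ p) q
  chain-points-distant-from-both {p₂ = p₂} Cq G D₁₂ p₁∈C p₂∈C = card-cong samePoint-isEquivalence
    ((λ ((P , p∈C , D₁) , p≁p₂) → P , p∈C , D₁ , distant-sym (onChain-distant G P P₂ p∈C p₂∈C p≁p₂)) ,
     (λ (P , p∈C , D₁ , D₂) → (P , p∈C , D₁) , λ p~p₂ → distant⇒¬samePoint 1≉0 D₂ (SP.sym p~p₂)))
    (card-remove samePoint-isEquivalence (chain-points-distant-from Cq G (distant⇒admissibleˡ D₁₂) p₁∈C)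
                 (P₂ , p₂∈C , D₁₂))
    where
      P₂ : Admissible p₂
      P₂ = distant⇒admissibleʳ D₁₂

module Incidences {c ℓ} (R : Ring c ℓ) (1≉0 : ¬ Ring._≈_ R (Ring.1# R) (Ring.0# R))
  (F : ChainGeometry.Subfield R) (_≟_ : Decidable (Ring._≈_ R)) where
  open Ring R using (_≈_)
  open ChainGeometry R
  open Subfield F using (inF)
  open Chains R 1≉0 F _≟_
  open import Data.Nat using (suc; _*_)
  open import Relation.Binary.PropositionalEquality using (_≡_)

  chains-points-incidence : ∀ {q v λ₀ λ₁ p₁} →
    Card _≈_ inF q → Admissible p₁ → Card SamePoint Admissible v →
    Card (SameChain F) GL₂ λ₀ → Card (SameChain F) (λ C → GL₂ C × OnChain F C p₁) λ₁ →
    λ₀ * suc q ≡ v * λ₁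
  chains-points-incidence Cq P₁ Cv L₀ L₁ =
    double-count sameChain-isEquivalence samePoint-isEquivalence
      L₀ (chain-points Cq) (λ _ _ C≡C′ (P , p∈C) → P , onChain-sameChain C≡C′ P p∈C)
      Cv (λ P → chains-through-one-point P₁ P L₁) (λ _ _ p~p′ (G , p∈C) → G , onChain-resp-samePoint p~p′ p∈C)
      (λ G (P , p∈C) → P , G , p∈C) (λ P (G , p∈C) → G , P , p∈C)

  chains-through-point-incidence : ∀ {q N λ₁ λ₂ p₁ p₂} →
    Card _≈_ inF q → Card _≈_ Everything N → Distant p₁ p₂ →
    Card (SameChain F) (λ C → GL₂ C × OnChain F C p₁) λ₁ →
    Card (SameChain F) (λ C → GL₂ C × OnChain F C p₁ × OnChain F C p₂) λ₂ →
    λ₁ * q ≡ N * λ₂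
  chains-through-point-incidence {p₁ = p₁} Cq CN D₁₂ L₁ L₂ =
    double-count sameChain-isEquivalence samePoint-isEquivalence
      L₁ (λ (G , p₁∈C) → chain-points-distant-from Cq G P₁ p₁∈C)
         (λ _ _ C≡C′ (P , p∈C , D) → P , onChain-sameChain C≡C′ P p∈C , D)
      (points-distant-from P₁ CN) (λ (_ , D) → chains-through-two-points D₁₂ D L₂)
         (λ _ _ p~p′ (G , p₁∈C , p∈C) → G , p₁∈C , onChain-resp-samePoint p~p′ p∈C)
      (λ (G , p₁∈C) (P , p∈C , D) → (P , D) , G , p₁∈C , p∈C)
      (λ (P , D) (G , p₁∈C , p∈C) → (G , p₁∈C) , P , p∈C , D)
    where
      P₁ : Admissible p₁
      P₁ = distant⇒admissibleˡ D₁₂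

  chains-through-two-points-incidence : ∀ {q r λ₂ λ₃ p₁ p₂ p₃} →
    Card _≈_ inF (suc q) → Card _≈_ IsUnit r → Distant p₁ p₂ → Distant p₁ p₃ → Distant p₂ p₃ →
    Card (SameChain F) (λ C → GL₂ C × OnChain F C p₁ × OnChain F C p₂) λ₂ →
    Card (SameChain F) (λ C → GL₂ C × OnChain F C p₁ × OnChain F C p₂ × OnChain F C p₃) λ₃ →
    λ₂ * q ≡ r * λ₃
  chains-through-two-points-incidence Cq Cr D₁₂ D₁₃ D₂₃ L₂ L₃ =
    double-count sameChain-isEquivalence samePoint-isEquivalence
      L₂ (λ (G , p₁∈C , p₂∈C) → chain-points-distant-from-both Cq G D₁₂ p₁∈C p₂∈C)
         (λ _ _ C≡C′ (P , p∈C , D) → P , onChain-sameChain C≡C′ P p∈C , D)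
      (points-distant-from-both D₁₂ Cr) (λ (_ , D₁ , D₂) → chains-through-three-points D₁₂ D₁₃ D₂₃ D₁ D₂ L₃)
         (λ _ _ p~p′ (G , p₁∈C , p₂∈C , p∈C) → G , p₁∈C , p₂∈C , onChain-resp-samePoint p~p′ p∈C)
      (λ (G , p₁∈C , p₂∈C) (P , p∈C , D) → (P , D) , G , p₁∈C , p₂∈C , p∈C)
      (λ (P , D) (G , p₁∈C , p₂∈C , p∈C) → (G , p₁∈C , p₂∈C) , P , p∈C , D)

open import Data.Nat using (ℕ; _*_; _^_; _∸_)
open import Relation.Binary.PropositionalEquality using (_≡_; refl; sym; trans; cong)

mainTheorem1 : ∀ {c ℓ : Level} (R : Ring c ℓ) → let open ChainGeometry R in
    ¬ (Ring._≈_ R (Ring.1# R) (Ring.0# R)) →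
    (F : Subfield) →
    (N q d rstar v λ₀ λ₁ λ₂ λ₃ : ℕ) →
    Card (Ring._≈_ R) Everything N →
    Card (Ring._≈_ R) (Subfield.inF F) q →
    N ≡ q ^ d →
    Card (Ring._≈_ R) IsUnit rstar →
    Card SamePoint Admissible v →
    (p₁ p₂ p₃ : Pair) →
    Admissible p₁ → Admissible p₂ → Admissible p₃ →
    Distant p₁ p₂ → Distant p₁ p₃ → Distant p₂ p₃ →
    Card (SameChain F) GL₂ λ₀ →
    Card (SameChain F) (λ g → GL₂ g × OnChain F g p₁) λ₁ →
    Card (SameChain F) (λ g → GL₂ g × OnChain F g p₁ × OnChain F g p₂) λ₂ →
    Card (SameChain F) (λ g → GL₂ g × OnChain F g p₁ × OnChain F g p₂ × OnChain F g p₃) λ₃ →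
    ((q ^ 2 ∸ 1) * λ₀ ≡ v * q ^ (d ∸ 1) * rstar * λ₃)
    × ((q ∸ 1) * λ₁ ≡ q ^ (d ∸ 1) * rstar * λ₃)
    × ((q ∸ 1) * λ₂ ≡ rstar * λ₃)
mainTheorem1 R 1≉0 F N q d r v λ₀ λ₁ λ₂ λ₃ CN Cq N≡q^d Cr Cv p₁ p₂ p₃ P₁ _ _ D₁₂ D₁₃ D₂₃ L₀ L₁ L₂ L₃
  with card-inhabited (Ring.isEquivalence R) Cq (ChainGeometry.Subfield.inF-0 F)
     | card-two (Ring.isEquivalence R) CN (lift _) (lift _) 1≉0
... | q′ , refl | _ , N≡2+k with ^-exponent-nonzero q d (trans (sym N≡q^d) N≡2+k)
...   | d′ , refl = incidence-arithmetic q′ (q ^ d′) {v = v}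
          (chains-points-incidence Cq P₁ Cv L₀ L₁)
          (trans (chains-through-point-incidence Cq CN D₁₂ L₁ L₂) (cong (_* λ₂) N≡q^d))
          (chains-through-two-points-incidence Cq Cr D₁₂ D₁₃ D₂₃ L₂ L₃)
  where
    open Incidences R 1≉0 F (λ _ _ → card-decidable (Ring.isEquivalence R) CN (lift _) (lift _))
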